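{- Let $(G,*)$ be a groupoid with at least two elements satisfying the identity $xy\approx x$. Then $s_n(*)=1$ and $s^{ac}_n(*)=n$ for all $n\ge1$. In particular these two equalities hold for the 2-element groupoid $(\{0,1\},*)$ with $x*y:=x$, and for the 3-element groupoids $\mathrm{SC}275$ (rows $0{:}\ 0\,0\,0$; $1{:}\ 1\,1\,1$; $2{:}\ 2\,2\,2$) and $\mathrm{SC}2029$ (rows $0{:}\ 0\,1\,2$; $1{:}\ 0\,1\,2$; $2{:}\ 0\,1\,2$).
   Context: A groupoid $(G,*)$ is a set with a binary operation; $xy$ denotes $x*y$. $\mathcal B_n$ is the set of bracketings of the word $x_1x_2\cdots x_n$ (all ways to insert parentheses, i.e. all binary trees with leaves $x_1,\dots,x_n$ in this order), and $\mathcal F_n$ is the set of full linear terms, obtained from bracketings by permuting the variables (each of $x_1,\dots,x_n$ occurs exactly once). Each such term $t$ induces an $n$-ary operation $t^*$ on $G$ by evaluation. The associative spectrum is $s_n(*):=|\{t^*:t\in\mathcal B_n\}|$ and the associative-commutative spectrum is $s^{ac}_n(*):=|\{t^*:t\in\mathcal F_n\}|$. A groupoid satisfies an identity $s\approx t$ if both sides take equal values under every assignment of elements of $G$ to the variables. A 3-element groupoid on $\{0,1,2\}$ is given by its Cayley table; "row $a{:}\ p\,q\,r$" means $a*0=p$, $a*1=q$, $a*2=r$. -}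

module Defs where

open import Data.Nat using (ℕ)
open import Data.Fin using (Fin; zero; suc)
open import Data.List using (List; [_]; _++_; allFin)
open import Data.List.Relation.Binary.Permutation.Propositional using (_↭_)
open import Data.Vec using (Vec; []; _∷_; lookup)
open import Data.Product using (Σ; ∃; _×_; proj₁)
open import Relation.Binary.PropositionalEquality using (_≡_)

data Term (n : ℕ) : Set where
  var : Fin n → Term n
  _·_ : Term n → Term n → Term n

leaves : {n : ℕ} → Term n → List (Fin n)
leaves (var i) = [ i ]
leaves (s · t) = leaves s ++ leaves t

eval : {n : ℕ} {G : Set} → (G → G → G) → Term n → (Fin n → G) → G
eval _*_ (var i) ρ = ρ i
eval _*_ (s · t) ρ = eval _*_ s ρ * eval _*_ t ρ

-- B_n : bracketings of x_1 x_2 ... x_n (leaves are exactly the variables in order)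
Bracketing : ℕ → Set
Bracketing n = Σ (Term n) λ t → leaves t ≡ allFin n

-- F_n : full linear terms (each variable occurs exactly once, in any order)
FullLinear : ℕ → Set
FullLinear n = Σ (Term n) λ t → leaves t ↭ allFin n

SameOp : {n : ℕ} {G : Set} → (G → G → G) → Term n → Term n → Set
SameOp {n} {G} _*_ t u = (ρ : Fin n → G) → eval _*_ t ρ ≡ eval _*_ u ρ

-- A has exactly k classes modulo the relation _∼_ :
-- k pairwise inequivalent representatives covering all of A.
HasCardinality : (A : Set) → (A → A → Set) → ℕ → Set
HasCardinality A _∼_ k =
  Σ (Fin k → A) λ f →
    ((i j : Fin k) → f i ∼ f j → i ≡ j) × ((a : A) → ∃ λ i → a ∼ f i)

AssocSpectrumIs : {G : Set} → (G → G → G) → ℕ → ℕ → Set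
AssocSpectrumIs _*_ n k =
  HasCardinality (Bracketing n) (λ t u → SameOp _*_ (proj₁ t) (proj₁ u)) k

ACSpectrumIs : {G : Set} → (G → G → G) → ℕ → ℕ → Set
ACSpectrumIs _*_ n k =
  HasCardinality (FullLinear n) (λ t u → SameOp _*_ (proj₁ t) (proj₁ u)) k

-- groupoid given by a Cayley table: row a lists a*0, a*1, ...
fromTable : {m : ℕ} → Vec (Vec (Fin m) m) m → Fin m → Fin m → Fin m
fromTable T a b = lookup (lookup T a) b

leftZero2 : Fin 2 → Fin 2 → Fin 2
leftZero2 x y = x

f0 f1 f2 : Fin 3
f0 = zero
f1 = suc zero
f2 = suc (suc zero)

SC275 : Fin 3 → Fin 3 → Fin 3
SC275 = fromTable ((f0 ∷ f0 ∷ f0 ∷ []) ∷ (f1 ∷ f1 ∷ f1 ∷ []) ∷ (f2 ∷ f2 ∷ f2 ∷ []) ∷ [])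

SC2029 : Fin 3 → Fin 3 → Fin 3
SC2029 = fromTable ((f0 ∷ f1 ∷ f2 ∷ []) ∷ (f0 ∷ f1 ∷ f2 ∷ []) ∷ (f0 ∷ f1 ∷ f2 ∷ []) ∷ [])

-- In a left-zero groupoid (xy ≈ x) every term operation is the projection onto
-- the leftmost variable of the term, and dually in a right-zero groupoid onto
-- the rightmost one. All bracketings of x₁⋯xₙ start with x₁, so they induce one
-- operation; a full linear term may start with any of the n variables, and with
-- two distinct elements at hand different projections are different operations.
-- SC2029 is right-zero rather than left-zero and is covered by the dual argument.
module Submission where

open import Defs
open import Data.Nat using (ℕ; suc; _≤_; s≤s; z≤n)
open import Data.Fin using (Fin; zero; suc; _≟_)
open import Data.Bool using (if_then_else_)
open import Data.Empty using (⊥-elim)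
open import Data.Product using (Σ; ∃; _×_; _,_; proj₁; proj₂)
open import Data.List using (List; []; _∷_; [_]; _++_; _∷ʳ_; allFin; tabulate)
open import Data.List.Properties using (++-assoc; ∷-injectiveˡ; ∷ʳ-injectiveʳ)
open import Data.List.Membership.Propositional.Properties using (∈-∃++; ∈-allFin)
open import Data.List.Relation.Binary.Permutation.Propositional
  using (_↭_; ↭-sym; ↭-trans; ↭-reflexive)
open import Data.List.Relation.Binary.Permutation.Propositional.Properties
  using (shift; ++-comm)
open import Data.Vec using (lookup; replicate) renaming (tabulate to tabulateᵥ)
open import Data.Vec.Properties using (lookup-replicate; lookup∘tabulate)
open import Function using (_∘_; id)
open import Relation.Nullary using (does; yes; no)
open import Relation.Nullary.Decidable using (dec-true; dec-false)
open import Relation.Binary.PropositionalEquality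
  using (_≡_; _≢_; refl; sym; trans; cong; module ≡-Reasoning)

private
  variable
    n : ℕ

leftmost rightmost : Term n → Fin n
leftmost (var i) = i
leftmost (s · t) = leftmost s
rightmost (var i) = i
rightmost (s · t) = rightmost t

leaves-leftmost : (t : Term n) → ∃ λ xs → leaves t ≡ leftmost t ∷ xs
leaves-leftmost (var i) = [] , refl
leaves-leftmost (s · t) with xs , eq ← leaves-leftmost s =
  xs ++ leaves t , cong (_++ leaves t) eq

leaves-rightmost : (t : Term n) → ∃ λ xs → leaves t ≡ xs ∷ʳ rightmost t
leaves-rightmost (var i) = [] , refl
leaves-rightmost (s · t) with xs , eq ← leaves-rightmost t =
  leaves s ++ xs , trans (cong (leaves s ++_) eq) (sym (++-assoc (leaves s) xs _))

leftmost-cong : (s t : Term n) → leaves s ≡ leaves t → leftmost s ≡ leftmost t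
leftmost-cong s t eq with _ , eqs ← leaves-leftmost s | _ , eqt ← leaves-leftmost t =
  ∷-injectiveˡ (trans (sym eqs) (trans eq eqt))

rightmost-cong : (s t : Term n) → leaves s ≡ leaves t → rightmost s ≡ rightmost t
rightmost-cong s t eq with xs , eqs ← leaves-rightmost s | ys , eqt ← leaves-rightmost t =
  ∷ʳ-injectiveʳ xs ys (trans (sym eqs) (trans eq eqt))

_◁_ : Fin n → List (Fin n) → Term n
i ◁ [] = var i
i ◁ (j ∷ js) = var i · (j ◁ js)

_▷_ : List (Fin n) → Fin n → Term n
[] ▷ i = var i
(j ∷ js) ▷ i = var j · (js ▷ i)

leaves-◁ : (i : Fin n) (js : List (Fin n)) → leaves (i ◁ js) ≡ i ∷ js
leaves-◁ i [] = refl
leaves-◁ i (j ∷ js) = cong (i ∷_) (leaves-◁ j js)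

leaves-▷ : (js : List (Fin n)) (i : Fin n) → leaves (js ▷ i) ≡ js ∷ʳ i
leaves-▷ [] i = refl
leaves-▷ (j ∷ js) i = cong (j ∷_) (leaves-▷ js i)

leftmost-◁ : (i : Fin n) (js : List (Fin n)) → leftmost (i ◁ js) ≡ i
leftmost-◁ i [] = refl
leftmost-◁ i (j ∷ js) = refl

rightmost-▷ : (js : List (Fin n)) (i : Fin n) → rightmost (js ▷ i) ≡ i
rightmost-▷ [] i = refl
rightmost-▷ (j ∷ js) i = rightmost-▷ js i

allFin-↭-∷ : (i : Fin n) → ∃ λ js → i ∷ js ↭ allFin n
allFin-↭-∷ i with xs , zs , eq ← ∈-∃++ (∈-allFin i) =
  xs ++ zs , ↭-trans (↭-sym (shift i xs zs)) (↭-reflexive (sym eq))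

leftmost-surjective : (i : Fin n) → Σ (FullLinear n) λ t → leftmost (proj₁ t) ≡ i
leftmost-surjective i with js , i∷js↭ ← allFin-↭-∷ i =
  (i ◁ js , ↭-trans (↭-reflexive (leaves-◁ i js)) i∷js↭) , leftmost-◁ i js

rightmost-surjective : (i : Fin n) → Σ (FullLinear n) λ t → rightmost (proj₁ t) ≡ i
rightmost-surjective i with js , i∷js↭ ← allFin-↭-∷ i =
  (js ▷ i , ↭-trans (↭-reflexive (leaves-▷ js i)) (↭-trans (++-comm js [ i ]) i∷js↭))
  , rightmost-▷ js i

module _ {G : Set} {_*_ : G → G → G} where

  eval-leftZero : ((x y : G) → x * y ≡ x) →
                  (t : Term n) (ρ : Fin n → G) → eval _*_ t ρ ≡ ρ (leftmost t)
  eval-leftZero zeroˡ (var i) ρ = refl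
  eval-leftZero zeroˡ (s · t) ρ = trans (zeroˡ _ _) (eval-leftZero zeroˡ s ρ)

  eval-rightZero : ((x y : G) → x * y ≡ y) →
                   (t : Term n) (ρ : Fin n → G) → eval _*_ t ρ ≡ ρ (rightmost t)
  eval-rightZero zeroʳ (var i) ρ = refl
  eval-rightZero zeroʳ (s · t) ρ = trans (zeroʳ _ _) (eval-rightZero zeroʳ t ρ)

projection-injective : {G : Set} {a b : G} → a ≢ b →
                       {i j : Fin n} → ((ρ : Fin n → G) → ρ i ≡ ρ j) → i ≡ j
projection-injective {G = G} {a} {b} a≢b {i} {j} same with i ≟ j
... | yes i≡j = i≡j
... | no i≢j = ⊥-elim (a≢b (begin
  a    ≡⟨ cong (if_then a else b) (sym (dec-true (i ≟ i) refl)) ⟩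
  ρ i  ≡⟨ same ρ ⟩
  ρ j  ≡⟨ cong (if_then a else b) (dec-false (j ≟ i) (i≢j ∘ sym)) ⟩
  b    ∎))
  where
  open ≡-Reasoning
  ρ : Fin _ → G
  ρ k = if does (k ≟ i) then a else b

module ProjectionSpectra
  {G : Set} (_*_ : G → G → G) {a b : G} (a≢b : a ≢ b)
  (select : ∀ {n} → Term n → Fin n)
  (eval-select : ∀ {n} (t : Term n) (ρ : Fin n → G) → eval _*_ t ρ ≡ ρ (select t))
  (select-cong : ∀ {n} (s t : Term n) → leaves s ≡ leaves t → select s ≡ select t)
  (select-surjective : ∀ {n} (i : Fin n) → Σ (FullLinear n) λ t → select (proj₁ t) ≡ i)
  where

  same-select⇒SameOp : (s t : Term n) → select s ≡ select t → SameOp _*_ s t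
  same-select⇒SameOp s t eq ρ =
    trans (eval-select s ρ) (trans (cong ρ eq) (sym (eval-select t ρ)))

  leftComb : (n : ℕ) → Bracketing (suc n)
  leftComb n = zero ◁ tabulate suc , leaves-◁ zero (tabulate suc)

  assocSpectrum : (n : ℕ) → 1 ≤ n → AssocSpectrumIs _*_ n 1
  assocSpectrum (suc n) (s≤s z≤n) = (λ _ → leftComb n) , (λ { zero zero _ → refl }) ,
    λ (t , t≡allFin) → zero , same-select⇒SameOp t (proj₁ (leftComb n))
      (select-cong t _ (trans t≡allFin (sym (proj₂ (leftComb n)))))

  acSpectrum : (n : ℕ) → ACSpectrumIs _*_ n n
  acSpectrum n = proj₁ ∘ select-surjective , injective , covering
    where
    representative : Fin n → Term n
    representative i = proj₁ (proj₁ (select-surjective i))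

    select-representative : (i : Fin n) → select (representative i) ≡ i
    select-representative i = proj₂ (select-surjective i)

    injective : (i j : Fin n) → SameOp _*_ (representative i) (representative j) → i ≡ j
    injective i j same = projection-injective a≢b λ ρ → begin
      ρ i                                ≡⟨ cong ρ (sym (select-representative i)) ⟩
      ρ (select (representative i))      ≡⟨ sym (eval-select (representative i) ρ) ⟩
      eval _*_ (representative i) ρ      ≡⟨ same ρ ⟩
      eval _*_ (representative j) ρ      ≡⟨ eval-select (representative j) ρ ⟩
      ρ (select (representative j))      ≡⟨ cong ρ (select-representative j) ⟩
      ρ j                                ∎
      where open ≡-Reasoning

    covering : (t : FullLinear n) → ∃ λ i → SameOp _*_ (proj₁ t) (representative i)
    covering (t , _) =
      select t , same-select⇒SameOp t _ (sym (select-representative (select t)))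

  spectra : (n : ℕ) → 1 ≤ n → AssocSpectrumIs _*_ n 1 × ACSpectrumIs _*_ n n
  spectra n 1≤n = assocSpectrum n 1≤n , acSpectrum n

Nontrivial : Set → Set
Nontrivial G = ∃ λ (a : G) → ∃ λ (b : G) → a ≢ b

leftZero-spectra : {G : Set} (_*_ : G → G → G) → Nontrivial G → ((x y : G) → x * y ≡ x) →
                   (n : ℕ) → 1 ≤ n → AssocSpectrumIs _*_ n 1 × ACSpectrumIs _*_ n n
leftZero-spectra _*_ (_ , _ , a≢b) zeroˡ =
  ProjectionSpectra.spectra _*_ a≢b leftmost (eval-leftZero zeroˡ) leftmost-cong leftmost-surjective

rightZero-spectra : {G : Set} (_*_ : G → G → G) → Nontrivial G → ((x y : G) → x * y ≡ y) →
                    (n : ℕ) → 1 ≤ n → AssocSpectrumIs _*_ n 1 × ACSpectrumIs _*_ n n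
rightZero-spectra _*_ (_ , _ , a≢b) zeroʳ =
  ProjectionSpectra.spectra _*_ a≢b rightmost (eval-rightZero zeroʳ) rightmost-cong rightmost-surjective

-- The Cayley tables of SC275 and SC2029 are tabulate (replicate 3) and replicate 3 (tabulate id).
SC275-leftZero : (x y : Fin 3) → SC275 x y ≡ x
SC275-leftZero x y =
  trans (cong (λ row → lookup row y) (lookup∘tabulate (replicate 3) x)) (lookup-replicate y x)

SC2029-rightZero : (x y : Fin 3) → SC2029 x y ≡ y
SC2029-rightZero x y =
  trans (cong (λ row → lookup row y) (lookup-replicate x (tabulateᵥ id))) (lookup∘tabulate id y)

Fin-nontrivial : (m : ℕ) → Nontrivial (Fin (suc (suc m)))
Fin-nontrivial m = zero , suc zero , λ ()

proposition3p1 : ((G : Set) (_*_ : G → G → G) →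
    (∃ λ (a : G) → ∃ λ (b : G) → a ≢ b) →
    ((x y : G) → x * y ≡ x) →
    (n : ℕ) → 1 ≤ n →
    AssocSpectrumIs _*_ n 1 × ACSpectrumIs _*_ n n)
    × ((n : ℕ) → 1 ≤ n →
    (AssocSpectrumIs leftZero2 n 1 × ACSpectrumIs leftZero2 n n)
    × (AssocSpectrumIs SC275 n 1 × ACSpectrumIs SC275 n n)
    × (AssocSpectrumIs SC2029 n 1 × ACSpectrumIs SC2029 n n))
proposition3p1 = (λ G _*_ → leftZero-spectra _*_) ,
  λ n 1≤n → leftZero-spectra leftZero2 (Fin-nontrivial 0) (λ _ _ → refl) n 1≤n
          , leftZero-spectra SC275 (Fin-nontrivial 1) SC275-leftZero n 1≤n
          , rightZero-spectra SC2029 (Fin-nontrivial 1) SC2029-rightZero n 1≤n
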